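{- Let $\mathcal{C}$ be either a Markov category or a restriction category (with restriction products). Then $\mathcal{C}$ is a domain category, i.e. $\mathrm{dom}(f);f=f$ for every arrow $f$ of $\mathcal{C}$.
   Context: Composition is diagrammatic ($f;g$ means first $f$, then $g$); the right unitor is $\rho_X:X\to X\otimes I$. A gs-monoidal category is a symmetric monoidal category $(\mathcal{C},\otimes,I)$ with, for each object $X$, arrows $!_X:X\to I$ and $\nabla_X:X\to X\otimes X$, compatible with the monoidal structure ($!_I=\mathrm{id}_I$, $!_{X\otimes Y}$, $\nabla_{X\otimes Y}$ built canonically from those of $X,Y$), with $\nabla_X$ coassociative and cocommutative and $(X,\nabla_X,!_X)$ a comonoid. For $f:X\to Y$, $\mathrm{dom}(f):=\nabla_X;(\mathrm{id}_X\otimes (f;!_Y));\rho^{ -1}_X:X\to X$. A domain category is a gs-monoidal category with $\mathrm{dom}(f);f=f$ for all $f$. A restriction category (with restriction products) is a gs-monoidal category in which every arrow $f:X\to Y$ is copyable: $f;\nabla_Y=\nabla_X;(f\otimes f)$. A Markov category is a gs-monoidal category in which every arrow $f:X\to Y$ is total: $f;!_Y=!_X$. -}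

module Defs where

-- Composition is diagrammatic: f ⨾ g = "first f, then g".

open import Level using (Level; suc; _⊔_)
open import Relation.Binary using (Rel; IsEquivalence)
open import Data.Sum using (_⊎_)

record GSMonoidal (o ℓ e : Level) : Set (suc (o ⊔ ℓ ⊔ e)) where
  infixr 9 _⨾_
  infixr 10 _⊗₀_ _⊗₁_
  infix  4 _≈_
  field
    Obj  : Set o
    _⇒_  : Obj → Obj → Set ℓ
    _≈_  : ∀ {A B} → Rel (A ⇒ B) e
    id   : ∀ {A} → A ⇒ A
    _⨾_  : ∀ {A B C} → A ⇒ B → B ⇒ C → A ⇒ C
    ≈-equiv   : ∀ {A B} → IsEquivalence (_≈_ {A} {B})
    ⨾-resp-≈  : ∀ {A B C} {f f′ : A ⇒ B} {g g′ : B ⇒ C} →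
                f ≈ f′ → g ≈ g′ → f ⨾ g ≈ f′ ⨾ g′
    identityˡ : ∀ {A B} {f : A ⇒ B} → id ⨾ f ≈ f
    identityʳ : ∀ {A B} {f : A ⇒ B} → f ⨾ id ≈ f
    assoc     : ∀ {A B C D} {f : A ⇒ B} {g : B ⇒ C} {h : C ⇒ D} →
                (f ⨾ g) ⨾ h ≈ f ⨾ (g ⨾ h)
    I     : Obj
    _⊗₀_  : Obj → Obj → Obj
    _⊗₁_  : ∀ {A B C D} → A ⇒ B → C ⇒ D → (A ⊗₀ C) ⇒ (B ⊗₀ D)
    ⊗-resp-≈ : ∀ {A B C D} {f f′ : A ⇒ B} {g g′ : C ⇒ D} →
               f ≈ f′ → g ≈ g′ → f ⊗₁ g ≈ f′ ⊗₁ g′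
    ⊗-id  : ∀ {A B} → id {A} ⊗₁ id {B} ≈ id
    ⊗-⨾   : ∀ {A B C D E F} {f : A ⇒ B} {g : B ⇒ C} {h : D ⇒ E} {k : E ⇒ F} →
            (f ⨾ g) ⊗₁ (h ⨾ k) ≈ (f ⊗₁ h) ⨾ (g ⊗₁ k)
    -- structural isomorphisms -----------------------------------------------
    -- λ : X → I ⊗ X,  ρ : X → X ⊗ I  (direction as in the paper), with inverses
    λ⇒ : ∀ {X} → X ⇒ (I ⊗₀ X)
    λ⇐ : ∀ {X} → (I ⊗₀ X) ⇒ X
    ρ⇒ : ∀ {X} → X ⇒ (X ⊗₀ I)
    ρ⇐ : ∀ {X} → (X ⊗₀ I) ⇒ X
    α⇒ : ∀ {X Y Z} → ((X ⊗₀ Y) ⊗₀ Z) ⇒ (X ⊗₀ (Y ⊗₀ Z))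
    α⇐ : ∀ {X Y Z} → (X ⊗₀ (Y ⊗₀ Z)) ⇒ ((X ⊗₀ Y) ⊗₀ Z)
    σ  : ∀ {X Y} → (X ⊗₀ Y) ⇒ (Y ⊗₀ X)
    λ-iso₁ : ∀ {X} → λ⇒ {X} ⨾ λ⇐ ≈ id
    λ-iso₂ : ∀ {X} → λ⇐ {X} ⨾ λ⇒ ≈ id
    ρ-iso₁ : ∀ {X} → ρ⇒ {X} ⨾ ρ⇐ ≈ id
    ρ-iso₂ : ∀ {X} → ρ⇐ {X} ⨾ ρ⇒ ≈ id
    α-iso₁ : ∀ {X Y Z} → α⇒ {X} {Y} {Z} ⨾ α⇐ ≈ id
    α-iso₂ : ∀ {X Y Z} → α⇐ {X} {Y} {Z} ⨾ α⇒ ≈ id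
    σ-iso  : ∀ {X Y} → σ {X} {Y} ⨾ σ ≈ id
    λ-nat : ∀ {X Y} {f : X ⇒ Y} → f ⨾ λ⇒ ≈ λ⇒ ⨾ (id ⊗₁ f)
    ρ-nat : ∀ {X Y} {f : X ⇒ Y} → f ⨾ ρ⇒ ≈ ρ⇒ ⨾ (f ⊗₁ id)
    α-nat : ∀ {X X′ Y Y′ Z Z′} {f : X ⇒ X′} {g : Y ⇒ Y′} {h : Z ⇒ Z′} →
            ((f ⊗₁ g) ⊗₁ h) ⨾ α⇒ ≈ α⇒ ⨾ (f ⊗₁ (g ⊗₁ h))
    σ-nat : ∀ {X X′ Y Y′} {f : X ⇒ X′} {g : Y ⇒ Y′} →
            (f ⊗₁ g) ⨾ σ ≈ σ ⨾ (g ⊗₁ f)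
    triangle : ∀ {X Y} → (ρ⇐ {X} ⊗₁ id {Y}) ≈ α⇒ ⨾ (id ⊗₁ λ⇐)
    pentagon : ∀ {W X Y Z} →
               (α⇒ {W} {X} {Y} ⊗₁ id {Z}) ⨾ α⇒ ⨾ (id ⊗₁ α⇒) ≈ α⇒ ⨾ α⇒
    hexagon  : ∀ {X Y Z} →
               α⇒ {X} {Y} {Z} ⨾ σ ⨾ α⇒ ≈ (σ ⊗₁ id) ⨾ α⇒ ⨾ (id ⊗₁ σ)
    ! : ∀ X → X ⇒ I
    ∇ : ∀ X → X ⇒ (X ⊗₀ X)
    !-I  : ! I ≈ id
    !-⊗  : ∀ {X Y} → ! (X ⊗₀ Y) ≈ (! X ⊗₁ ! Y) ⨾ λ⇐
    ∇-I  : ∇ I ≈ λ⇒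
    ∇-⊗  : ∀ {X Y} → ∇ (X ⊗₀ Y) ≈
             (∇ X ⊗₁ ∇ Y) ⨾ α⇒ ⨾ (id ⊗₁ α⇐) ⨾ (id ⊗₁ (σ ⊗₁ id))
                          ⨾ (id ⊗₁ α⇒) ⨾ α⇐
    ∇-assoc : ∀ {X} → ∇ X ⨾ (∇ X ⊗₁ id) ⨾ α⇒ ≈ ∇ X ⨾ (id ⊗₁ ∇ X)
    ∇-comm  : ∀ {X} → ∇ X ⨾ σ ≈ ∇ X
    counitˡ : ∀ {X} → ∇ X ⨾ (! X ⊗₁ id) ⨾ λ⇐ ≈ id
    counitʳ : ∀ {X} → ∇ X ⨾ (id ⊗₁ ! X) ⨾ ρ⇐ ≈ id

  dom : ∀ {X Y} → X ⇒ Y → X ⇒ X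
  dom {X} {Y} f = ∇ X ⨾ (id ⊗₁ (f ⨾ ! Y)) ⨾ ρ⇐

module _ {o ℓ e} (C : GSMonoidal o ℓ e) where
  open GSMonoidal C

  IsMarkov : Set (o ⊔ ℓ ⊔ e)
  IsMarkov = ∀ {X Y} (f : X ⇒ Y) → f ⨾ ! Y ≈ ! X

  -- every arrow is copyable (restriction category with restriction products)
  IsRestriction : Set (o ⊔ ℓ ⊔ e)
  IsRestriction = ∀ {X Y} (f : X ⇒ Y) → f ⨾ ∇ Y ≈ ∇ X ⨾ (f ⊗₁ f)

  IsDomain : Set (o ⊔ ℓ ⊔ e)
  IsDomain = ∀ {X Y} (f : X ⇒ Y) → dom f ⨾ f ≈ f

{-# OPTIONS --safe #-}
module Submission where

-- A total arrow has trivial domain by the right counit law.  For a copyable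
-- arrow f, naturality of ρ⁻¹ turns dom f ; f into ∇ ; (f ⊗ f) ; (id ⊗ !) ; ρ⁻¹,
-- and copying f past ∇ reduces this to f ; ∇ ; (id ⊗ !) ; ρ⁻¹ = f.

open import Defs
open import Level using (Level)
open import Data.Sum using (_⊎_; inj₁; inj₂)
open import Relation.Binary using (Setoid; IsEquivalence)
import Relation.Binary.Reasoning.Setoid as SetoidReasoning

module GSMonoidalProperties {o ℓ e : Level} (C : GSMonoidal o ℓ e) where
  open GSMonoidal C

  hom : Obj → Obj → Setoid ℓ e
  hom A B = record { Carrier = A ⇒ B ; _≈_ = _≈_ ; isEquivalence = ≈-equiv }

  module _ {A B : Obj} where
    open IsEquivalence (≈-equiv {A} {B}) public
      using () renaming (refl to ≈-refl; sym to ≈-sym; trans to ≈-trans)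

  Total : ∀ {X Y} → X ⇒ Y → Set e
  Total {X} {Y} f = f ⨾ ! Y ≈ ! X

  Copyable : ∀ {X Y} → X ⇒ Y → Set e
  Copyable {X} {Y} f = f ⨾ ∇ Y ≈ ∇ X ⨾ (f ⊗₁ f)

  ⨾-congˡ : ∀ {A B D} {f : A ⇒ B} {g g′ : B ⇒ D} → g ≈ g′ → f ⨾ g ≈ f ⨾ g′
  ⨾-congˡ = ⨾-resp-≈ ≈-refl

  ⨾-congʳ : ∀ {A B D} {f f′ : A ⇒ B} {g : B ⇒ D} → f ≈ f′ → f ⨾ g ≈ f′ ⨾ g
  ⨾-congʳ p = ⨾-resp-≈ p ≈-refl

  ρ⇐-nat : ∀ {X Y} (f : X ⇒ Y) → ρ⇐ ⨾ f ≈ (f ⊗₁ id) ⨾ ρ⇐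
  ρ⇐-nat {X} {Y} f = begin
    ρ⇐ ⨾ f                          ≈⟨ identityʳ ⟨
    (ρ⇐ ⨾ f) ⨾ id                   ≈⟨ ⨾-congˡ ρ-iso₁ ⟨
    (ρ⇐ ⨾ f) ⨾ ρ⇒ ⨾ ρ⇐              ≈⟨ assoc ⟩
    ρ⇐ ⨾ f ⨾ ρ⇒ ⨾ ρ⇐                ≈⟨ ⨾-congˡ assoc ⟨
    ρ⇐ ⨾ (f ⨾ ρ⇒) ⨾ ρ⇐              ≈⟨ ⨾-congˡ (⨾-congʳ ρ-nat) ⟩
    ρ⇐ ⨾ (ρ⇒ ⨾ (f ⊗₁ id)) ⨾ ρ⇐      ≈⟨ ⨾-congˡ assoc ⟩
    ρ⇐ ⨾ ρ⇒ ⨾ (f ⊗₁ id) ⨾ ρ⇐        ≈⟨ assoc ⟨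
    (ρ⇐ ⨾ ρ⇒) ⨾ (f ⊗₁ id) ⨾ ρ⇐      ≈⟨ ⨾-congʳ ρ-iso₂ ⟩
    id ⨾ (f ⊗₁ id) ⨾ ρ⇐             ≈⟨ identityˡ ⟩
    (f ⊗₁ id) ⨾ ρ⇐                  ∎
    where open SetoidReasoning (hom (X ⊗₀ I) Y)

  id⊗-⨾-⊗id : ∀ {A B C D} {f : A ⇒ B} {g : C ⇒ D} →
              (id ⊗₁ g) ⨾ (f ⊗₁ id) ≈ f ⊗₁ g
  id⊗-⨾-⊗id = ≈-trans (≈-sym ⊗-⨾) (⊗-resp-≈ identityˡ identityʳ)

  ⊗-⨾-id⊗ : ∀ {A B C D E} {f : A ⇒ B} {g : C ⇒ D} {h : D ⇒ E} →
            (f ⊗₁ g) ⨾ (id ⊗₁ h) ≈ f ⊗₁ (g ⨾ h)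
  ⊗-⨾-id⊗ = ≈-trans (≈-sym ⊗-⨾) (⊗-resp-≈ identityʳ ≈-refl)

  dom-⨾ : ∀ {X Y} (f : X ⇒ Y) → dom f ⨾ f ≈ ∇ X ⨾ (f ⊗₁ (f ⨾ ! Y)) ⨾ ρ⇐
  dom-⨾ {X} {Y} f = begin
    (∇ X ⨾ (id ⊗₁ (f ⨾ ! Y)) ⨾ ρ⇐) ⨾ f              ≈⟨ assoc ⟩
    ∇ X ⨾ ((id ⊗₁ (f ⨾ ! Y)) ⨾ ρ⇐) ⨾ f              ≈⟨ ⨾-congˡ assoc ⟩
    ∇ X ⨾ (id ⊗₁ (f ⨾ ! Y)) ⨾ ρ⇐ ⨾ f                ≈⟨ ⨾-congˡ (⨾-congˡ (ρ⇐-nat f)) ⟩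
    ∇ X ⨾ (id ⊗₁ (f ⨾ ! Y)) ⨾ (f ⊗₁ id) ⨾ ρ⇐        ≈⟨ ⨾-congˡ assoc ⟨
    ∇ X ⨾ ((id ⊗₁ (f ⨾ ! Y)) ⨾ (f ⊗₁ id)) ⨾ ρ⇐      ≈⟨ ⨾-congˡ (⨾-congʳ id⊗-⨾-⊗id) ⟩
    ∇ X ⨾ (f ⊗₁ (f ⨾ ! Y)) ⨾ ρ⇐                     ∎
    where open SetoidReasoning (hom X Y)

  total⇒dom≈id : ∀ {X Y} {f : X ⇒ Y} → Total f → dom f ≈ id
  total⇒dom≈id total = ≈-trans (⨾-congˡ (⨾-congʳ (⊗-resp-≈ ≈-refl total))) counitʳ

  total⇒dom-⨾ : ∀ {X Y} {f : X ⇒ Y} → Total f → dom f ⨾ f ≈ f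
  total⇒dom-⨾ total = ≈-trans (⨾-congʳ (total⇒dom≈id total)) identityˡ

  copyable⇒dom-⨾ : ∀ {X Y} {f : X ⇒ Y} → Copyable f → dom f ⨾ f ≈ f
  copyable⇒dom-⨾ {X} {Y} {f} copy = begin
    dom f ⨾ f                                   ≈⟨ dom-⨾ f ⟩
    ∇ X ⨾ (f ⊗₁ (f ⨾ ! Y)) ⨾ ρ⇐                 ≈⟨ ⨾-congˡ (⨾-congʳ ⊗-⨾-id⊗) ⟨
    ∇ X ⨾ ((f ⊗₁ f) ⨾ (id ⊗₁ ! Y)) ⨾ ρ⇐         ≈⟨ ⨾-congˡ assoc ⟩
    ∇ X ⨾ (f ⊗₁ f) ⨾ (id ⊗₁ ! Y) ⨾ ρ⇐           ≈⟨ assoc ⟨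
    (∇ X ⨾ (f ⊗₁ f)) ⨾ (id ⊗₁ ! Y) ⨾ ρ⇐         ≈⟨ ⨾-congʳ copy ⟨
    (f ⨾ ∇ Y) ⨾ (id ⊗₁ ! Y) ⨾ ρ⇐                ≈⟨ assoc ⟩
    f ⨾ ∇ Y ⨾ (id ⊗₁ ! Y) ⨾ ρ⇐                  ≈⟨ ⨾-congˡ counitʳ ⟩
    f ⨾ id                                      ≈⟨ identityʳ ⟩
    f                                           ∎
    where open SetoidReasoning (hom X Y)

lemma3p7 : ∀ {o ℓ e : Level} (C : GSMonoidal o ℓ e) →
    IsMarkov C ⊎ IsRestriction C → IsDomain C
lemma3p7 C (inj₁ markov)      f = total⇒dom-⨾ (markov f)
  where open GSMonoidalProperties C
lemma3p7 C (inj₂ restriction) f = copyable⇒dom-⨾ (restriction f)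
  where open GSMonoidalProperties C
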